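{- Let $G$ be a finite connected graph, let $x\ge 1$ and $y\ge 1$ be integers with $x+y\le |V(G)|$, and let $d$ be the $y$-set-diameter of $G$. In the game on $G$ starting with $y$ knowledgeable and $x$ ignorant agents, Adversary has a strategy forcing the time until all agents are knowledgeable to be at least $d/2$. In particular (the case $y=1$), any Agents win of $\text{BROADCAST}(G,x+1)$ takes time at least $d/2$.
   Context: For a finite connected graph $G$, the game with $x$ ignorant and $y$ knowledgeable agents is played as follows. Setup: Adversary places $y$ knowledgeable and $x$ ignorant agents on $x+y$ distinct vertices of $G$. At each time $t=1,2,\ldots$: first Adversary selects an arbitrary connected spanning subgraph $G_t$ of $G$; then each agent either stays at its vertex or moves to a vertex adjacent to it in $G_t$. If after this move several agents are at the same vertex and at least one of them was knowledgeable at time $t-1$, all of them become knowledgeable at time $t$. Agents win once all agents are knowledgeable; the time is the number of rounds until this happens. $\text{BROADCAST}(G,k)$ is the case of $1$ knowledgeable and $k-1$ ignorant agents. The $y$-set-diameter of $G$ is the maximum, over a vertex $u$ and a set $Y$ of $y$ vertices of $G$, of the distance in $G$ from $u$ to $Y$ (the minimum distance from $u$ to a vertex of $Y$). -}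

module Defs where

open import Level using (Level)
open import Data.Nat using (ℕ; zero; suc; _≤_; _<_)
open import Data.Fin using (Fin; toℕ)
open import Data.Fin.Subset using (Subset; _∈_; ∣_∣)
open import Data.Product using (Σ; ∃; _×_; _,_)
open import Data.Sum using (_⊎_)
open import Data.Unit.Polymorphic using (⊤)
open import Relation.Nullary using (¬_)
open import Relation.Binary.PropositionalEquality using (_≡_)

record Graph (n : ℕ) : Set₁ where
  field
    Adj    : Fin n → Fin n → Set
    sym    : ∀ {u v} → Adj u v → Adj v u
    irrefl : ∀ {u} → ¬ Adj u u
open Graph public

data Walk {n : ℕ} (R : Fin n → Fin n → Set) : Fin n → Fin n → ℕ → Set where
  here : ∀ {u} → Walk R u u zero
  step : ∀ {u v w k} → R u v → Walk R v w k → Walk R u w (suc k)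

Connected : {n : ℕ} → (Fin n → Fin n → Set) → Set
Connected R = ∀ u v → ∃ λ k → Walk R u v k

SetDist : {n : ℕ} → Graph n → Fin n → Subset n → ℕ → Set
SetDist G u Y k =
  (Σ _ λ v → v ∈ Y × Walk (Adj G) u v k)
  × (∀ v → v ∈ Y → ∀ j → Walk (Adj G) u v j → k ≤ j)

IsSetDiameter : {n : ℕ} → Graph n → ℕ → ℕ → Set
IsSetDiameter G y d =
  (Σ _ λ u → Σ _ λ Y → ∣ Y ∣ ≡ y × SetDist G u Y d)
  × (∀ u Y k → ∣ Y ∣ ≡ y → SetDist G u Y k → k ≤ d)

record ConnSpanningSubgraph {n : ℕ} (G : Graph n) : Set₁ where
  field
    H    : Fin n → Fin n → Set
    sub  : ∀ {u v} → H u v → Adj G u v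
    symH : ∀ {u v} → H u v → H v u
    conn : Connected H
open ConnSpanningSubgraph public

record State (n m : ℕ) : Set₁ where
  field
    pos : Fin m → Fin n
    K   : Fin m → Set
open State public

AllKnow : {n m : ℕ} → State n m → Set
AllKnow s = ∀ i → K s i

LegalMove : {n m : ℕ} {G : Graph n} → ConnSpanningSubgraph G → State n m → (Fin m → Fin n) → Set
LegalMove Ht s p = ∀ i → p i ≡ pos s i ⊎ H Ht (pos s i) (p i)

next : {n m : ℕ} → State n m → (Fin m → Fin n) → State n m
next s p = record { pos = p ; K = λ i → Σ _ λ j → p j ≡ p i × K s j }

-- AdvDelays G k s : from state s (current time t), Adversary can play so that,
-- whatever the agents do, the states at times t, t+1, ..., t+k-1 are all not
-- all-knowledgeable.
AdvDelays : {n m : ℕ} → Graph n → ℕ → State n m → Set₁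
AdvDelays G zero s = ⊤
AdvDelays G (suc k) s =
  (¬ AllKnow s) ×
  Σ (ConnSpanningSubgraph G) λ Ht → ∀ p → LegalMove Ht s p → AdvDelays G k (next s p)

initial : {n : ℕ} (y x : ℕ) → (Fin (y Data.Nat.+ x) → Fin n) → State n (y Data.Nat.+ x)
initial y x p = record { pos = p ; K = λ i → toℕ i < y }

{-# OPTIONS --safe #-}
-- Choose u and Y with dist(u, Y) = d. Adversary puts the knowledgeable agents on Y and an
-- ignorant agent a on u, and then always plays G itself. Knowledge travels only with agents,
-- one edge per round, so after t rounds every knowledgeable agent is within distance t of Y,
-- while a is within distance t of u. If a were knowledgeable, u would be within 2t of Y,
-- forcing d ≤ 2t.
module Submission where

open import Defs hiding (sym)

open import Data.Unit.Polymorphic using (tt)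
open import Data.Nat using (ℕ; zero; suc; _+_; _*_; _≤_; _<_; z≤n; s≤s)
open import Data.Nat.Properties
  using ( ≤-trans; ≤-<-trans; <⇒≱; +-comm; +-suc; +-identityʳ; +-mono-≤; *-monoʳ-≤
        ; m≤n⇒m≤1+n; m≤m+n; m<m+n; suc-injective)
open import Data.Fin using (Fin; toℕ; inject≤; fromℕ<; _≟_) renaming (zero to fzero; suc to fsuc)
open import Data.Fin.Properties using (toℕ-inject≤; toℕ-fromℕ<; inject≤-injective; injective⇒≤)
open import Data.Fin.Subset using (Subset; _∈_; _∉_; ∣_∣; inside; outside)
open import Data.Fin.Subset.Properties using (_∈?_; drop-there)
import Data.Vec.Base as Vec
open import Data.List using (List; []; _∷_; _++_; length; filter; tabulate; allFin; lookup)
open import Data.List.Properties using (filter-accept; filter-reject)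
open import Data.List.Relation.Unary.Any as Any using (there; index)
open import Data.List.Relation.Unary.Any.Properties using (lookup-index)
import Data.List.Relation.Unary.All as All
open import Data.List.Relation.Unary.All.Properties using (all-filter)
open import Data.List.Relation.Unary.AllPairs using (_∷_)
open import Data.List.Relation.Unary.Unique.Propositional using (Unique)
open import Data.List.Relation.Unary.Unique.Propositional.Properties using (++⁺; filter⁺; allFin⁺)
import Data.List.Membership.Propositional as List
open import Data.List.Membership.Propositional.Properties
  using (∈-lookup; ∈-++⁺ˡ; ∈-++⁺ʳ; ∈-filter⁺; ∈-filter⁻; ∈-allFin)
open import Data.Product using (Σ; ∃; _×_; _,_; proj₁; proj₂)
open import Data.Sum as Sum using (_⊎_; inj₁; inj₂)
open import Data.Empty using (⊥-elim)
open import Function using (id; _∘_; _⇔_; mk⇔; Equivalence; case_of_)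
open import Function.Definitions using (Injective)
open import Relation.Nullary using (¬_; yes; no)
open import Relation.Nullary.Decidable using (¬?; _×-dec_)
open import Relation.Binary.PropositionalEquality
  using (_≡_; _≢_; refl; sym; trans; cong; subst; subst₂; module ≡-Reasoning)
open import Relation.Unary using (Decidable)

lookup-injective : ∀ {A : Set} {xs : List A} → Unique xs → Injective _≡_ _≡_ (lookup xs)
lookup-injective (_ ∷ _) {fzero} {fzero} _ = refl
lookup-injective (x≢xs ∷ _) {fzero} {fsuc j} eq = ⊥-elim (All.lookup x≢xs (∈-lookup j) eq)
lookup-injective (x≢xs ∷ _) {fsuc i} {fzero} eq = ⊥-elim (All.lookup x≢xs (∈-lookup i) (sym eq))
lookup-injective (_ ∷ xs-unique) {fsuc i} {fsuc j} eq = cong fsuc (lookup-injective xs-unique eq)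

lookup-++-<-∈ : ∀ {A : Set} (xs ys : List A) (k : Fin (length (xs ++ ys))) →
  toℕ k < length xs → lookup (xs ++ ys) k List.∈ xs
lookup-++-<-∈ (_ ∷ xs) ys fzero _ = Any.here refl
lookup-++-<-∈ (_ ∷ xs) ys (fsuc k) (s≤s k<xs) = there (lookup-++-<-∈ xs ys k k<xs)

lookup-++-length : ∀ {A : Set} (xs : List A) (z : A) ys (k : Fin (length (xs ++ z ∷ ys))) →
  toℕ k ≡ length xs → lookup (xs ++ z ∷ ys) k ≡ z
lookup-++-length [] z ys fzero _ = refl
lookup-++-length (_ ∷ xs) z ys (fsuc k) k≡ = lookup-++-length xs z ys k (suc-injective k≡)

covers⇒n≤length : ∀ {n} {xs : List (Fin n)} → (∀ v → v List.∈ xs) → n ≤ length xs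
covers⇒n≤length {xs = xs} covers = injective⇒≤ position-injective
  where
  position-injective : Injective _≡_ _≡_ (index ∘ covers)
  position-injective {v} {w} eq = begin
    v                            ≡⟨ lookup-index (covers v) ⟩
    lookup xs (index (covers v)) ≡⟨ cong (lookup xs) eq ⟩
    lookup xs (index (covers w)) ≡⟨ lookup-index (covers w) ⟨
    w                            ∎
    where open ≡-Reasoning

⇔-tail : ∀ {n} {b} {Z : Subset n} {i} {Q : Set} → Q ⇔ fsuc i ∈ b Vec.∷ Z → Q ⇔ i ∈ Z
⇔-tail Q⇔ = mk⇔ (drop-there ∘ Equivalence.to Q⇔) (Equivalence.from Q⇔ ∘ Vec.there)

length-filter-tabulate : ∀ {n} {A : Set} {P : A → Set} (P? : Decidable P) (Z : Subset n) (f : Fin n → A) →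
  (∀ i → P (f i) ⇔ i ∈ Z) → length (filter P? (tabulate f)) ≡ ∣ Z ∣
length-filter-tabulate P? Vec.[] f P⇔Z = refl
length-filter-tabulate P? (b Vec.∷ Z) f P⇔Z with b | P⇔Z fzero
... | inside | P0⇔
  rewrite filter-accept P? {f fzero} {tabulate (f ∘ fsuc)} (Equivalence.from P0⇔ Vec.here) =
  cong suc (length-filter-tabulate P? Z (f ∘ fsuc) (λ i → ⇔-tail (P⇔Z (fsuc i))))
... | outside | P0⇔
  rewrite filter-reject P? {f fzero} {tabulate (f ∘ fsuc)} (λ P0 → case Equivalence.to P0⇔ P0 of λ ()) =
  length-filter-tabulate P? Z (f ∘ fsuc) (λ i → ⇔-tail (P⇔Z (fsuc i)))

members : ∀ {n} → Subset n → List (Fin n)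
members {n} Y = filter (_∈? Y) (allFin n)

length-members : ∀ {n} (Y : Subset n) → length (members Y) ≡ ∣ Y ∣
length-members Y = length-filter-tabulate (_∈? Y) Y id (λ _ → mk⇔ id id)

∈-members⁻ : ∀ {n} {Y : Subset n} {v} → v List.∈ members Y → v ∈ Y
∈-members⁻ {n} {Y} = proj₂ ∘ ∈-filter⁻ (_∈? Y) {xs = allFin n}

module _ {n : ℕ} (Y : Subset n) (u : Fin n) (u∉Y : u ∉ Y) where

  private
    Rest : Fin n → Set
    Rest v = v ∉ Y × ¬ v ≡ u

    rest? : Decidable Rest
    rest? v = ¬? (v ∈? Y) ×-dec ¬? (v ≟ u)

    rest : List (Fin n)
    rest = filter rest? (allFin n)

    ∈-rest⁻ : ∀ {v} → v List.∈ rest → Rest v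
    ∈-rest⁻ = proj₂ ∘ ∈-filter⁻ rest? {xs = allFin n}

  vertexOrder : List (Fin n)
  vertexOrder = members Y ++ u ∷ rest

  vertexOrder-unique : Unique vertexOrder
  vertexOrder-unique = ++⁺ (filter⁺ (_∈? Y) (allFin⁺ n)) (u∉rest ∷ filter⁺ rest? (allFin⁺ n)) disjoint
    where
    u∉rest : All.All (u ≢_) rest
    u∉rest = All.map (λ (_ , v≢u) u≡v → v≢u (sym u≡v)) (all-filter rest? (allFin n))

    disjoint : ∀ {v} → ¬ (v List.∈ members Y × v List.∈ u ∷ rest)
    disjoint (u∈Y , Any.here refl) = u∉Y (∈-members⁻ u∈Y)
    disjoint (v∈Y , there v∈rest) = proj₁ (∈-rest⁻ v∈rest) (∈-members⁻ v∈Y)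

  ∈-vertexOrder : ∀ v → v List.∈ vertexOrder
  ∈-vertexOrder v with v ∈? Y | v ≟ u
  ... | yes v∈Y | _        = ∈-++⁺ˡ (∈-filter⁺ (_∈? Y) (∈-allFin v) v∈Y)
  ... | no _    | yes refl = ∈-++⁺ʳ (members Y) (Any.here refl)
  ... | no v∉Y  | no v≢u   = ∈-++⁺ʳ (members Y) (there (∈-filter⁺ rest? (∈-allFin v) (v∉Y , v≢u)))

  injective-placement : ∀ x → 0 < x → ∣ Y ∣ + x ≤ n →
    Σ (Fin (∣ Y ∣ + x) → Fin n) λ p →
      Injective _≡_ _≡_ p × (∀ i → toℕ i < ∣ Y ∣ → p i ∈ Y) × ∃ λ a → p a ≡ u
  injective-placement x 0<x ∣Y∣+x≤n = p , p-injective , p-on-Y , a , p-at-u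
    where
    fits : ∣ Y ∣ + x ≤ length vertexOrder
    fits = ≤-trans ∣Y∣+x≤n (covers⇒n≤length ∈-vertexOrder)

    p : Fin (∣ Y ∣ + x) → Fin n
    p i = lookup vertexOrder (inject≤ i fits)

    p-injective : Injective _≡_ _≡_ p
    p-injective {i} {j} = inject≤-injective fits fits i j ∘ lookup-injective vertexOrder-unique

    p-on-Y : ∀ i → toℕ i < ∣ Y ∣ → p i ∈ Y
    p-on-Y i i<∣Y∣ = ∈-members⁻ (lookup-++-<-∈ (members Y) (u ∷ rest) (inject≤ i fits) i<length)
      where
      i<length : toℕ (inject≤ i fits) < length (members Y)
      i<length = subst₂ _<_ (sym (toℕ-inject≤ i fits)) (sym (length-members Y)) i<∣Y∣

    ∣Y∣<∣Y∣+x : ∣ Y ∣ < ∣ Y ∣ + x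
    ∣Y∣<∣Y∣+x = m<m+n ∣ Y ∣ 0<x

    a : Fin (∣ Y ∣ + x)
    a = fromℕ< ∣Y∣<∣Y∣+x

    p-at-u : p a ≡ u
    p-at-u = lookup-++-length (members Y) u rest (inject≤ a fits) (begin
      toℕ (inject≤ a fits) ≡⟨ toℕ-inject≤ a fits ⟩
      toℕ a                ≡⟨ toℕ-fromℕ< ∣Y∣<∣Y∣+x ⟩
      ∣ Y ∣                ≡⟨ length-members Y ⟨
      length (members Y)   ∎)
      where open ≡-Reasoning

module _ {n : ℕ} {R : Fin n → Fin n → Set} where

  infixr 5 _++ʷ_
  _++ʷ_ : ∀ {u v w j k} → Walk R u v j → Walk R v w k → Walk R u w (j + k)
  here ++ʷ q = q
  step e p ++ʷ q = step e (p ++ʷ q)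

  snocʷ : ∀ {u v w k} → Walk R u v k → R v w → Walk R u w (suc k)
  snocʷ here e = step e here
  snocʷ (step e′ p) e = step e′ (snocʷ p e)

  reverseʷ : (∀ {v w} → R v w → R w v) → ∀ {u v k} → Walk R u v k → Walk R v u k
  reverseʷ R-sym here = here
  reverseʷ R-sym (step e p) = snocʷ (reverseʷ R-sym p) (R-sym e)

Within : ∀ {n} → Graph n → ℕ → (Fin n → Set) → Fin n → Set
Within G t S v = ∃ λ w → S w × ∃ λ j → j ≤ t × Walk (Adj G) v w j

module _ {n : ℕ} (G : Graph n) {S : Fin n → Set} where

  within-of-∈ : ∀ {t v} → S v → Within G t S v
  within-of-∈ {v = v} Sv = v , Sv , 0 , z≤n , here

  within-move : ∀ {t v w} → Within G t S v → w ≡ v ⊎ Adj G v w → Within G (suc t) S w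
  within-move (z , Sz , j , j≤t , walk) (inj₁ refl) = z , Sz , j , m≤n⇒m≤1+n j≤t , walk
  within-move (z , Sz , j , j≤t , walk) (inj₂ e) = z , Sz , suc j , s≤s j≤t , step (Graph.sym G e) walk

setDist≤within+within : ∀ {n} (G : Graph n) {u Y d t₁ t₂ v} → SetDist G u Y d →
  Within G t₁ (_≡ u) v → Within G t₂ (_∈ Y) v → d ≤ t₁ + t₂
setDist≤within+within G (_ , minimal) (_ , refl , j₁ , j₁≤t₁ , v⇝u) (w , w∈Y , j₂ , j₂≤t₂ , v⇝w) =
  ≤-trans (minimal w w∈Y _ (reverseʷ (Graph.sym G) v⇝u ++ʷ v⇝w)) (+-mono-≤ j₁≤t₁ j₂≤t₂)

setDist-suc⇒∉ : ∀ {n} (G : Graph n) {u Y d} → SetDist G u Y (suc d) → u ∉ Y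
setDist-suc⇒∉ G (_ , minimal) u∈Y with minimal _ u∈Y 0 here
... | ()

wholeGraph : ∀ {n} (G : Graph n) → Connected (Adj G) → ConnSpanningSubgraph G
wholeGraph G connected = record { H = Adj G ; sub = id ; symH = Graph.sym G ; conn = connected }

module _ {n m : ℕ} (G : Graph n) where

  delays-by-fixed-graph : (Ht : ConnSpanningSubgraph G) (I : ℕ → State n m → Set) →
    (∀ {k s} → I k s → ¬ AllKnow s) →
    (∀ {k s p} → I (suc k) s → LegalMove Ht s p → I k (next s p)) →
    ∀ k {s} → I k s → AdvDelays G (suc k) s
  delays-by-fixed-graph Ht I ¬all preserved zero Is = ¬all Is , Ht , λ _ _ → tt
  delays-by-fixed-graph Ht I ¬all preserved (suc k) Is =
    ¬all Is , Ht , λ p move → delays-by-fixed-graph Ht I ¬all preserved k (preserved Is move)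

  record Confined (Y : Subset n) (u : Fin n) (a : Fin m) (t : ℕ) (s : State n m) : Set where
    field
      knowers-near-Y : ∀ i → K s i → Within G t (_∈ Y) (pos s i)
      a-near-u       : Within G t (_≡ u) (pos s a)

  module _ {Y : Subset n} {u : Fin n} {a : Fin m} where

    confined-next : (Ht : ConnSpanningSubgraph G) → ∀ {t s p} →
      Confined Y u a t s → LegalMove Ht s p → Confined Y u a (suc t) (next s p)
    confined-next Ht {s = s} {p} confined move = record
      { knowers-near-Y = λ { i (j , pj≡pi , Kj) →
          subst (Within G _ _) pj≡pi (within-move G (knowers-near-Y j Kj) (moved j)) }
      ; a-near-u = within-move G a-near-u (moved a)
      }
      where
      open Confined confined
      moved : ∀ i → p i ≡ pos s i ⊎ Adj G (pos s i) (p i)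
      moved i = Sum.map₂ (sub Ht) (move i)

    confined-¬AllKnow : ∀ {d t s} → SetDist G u Y d → Confined Y u a t s → 2 * t < d → ¬ AllKnow s
    confined-¬AllKnow {d} {t} dist confined 2t<d all =
      <⇒≱ 2t<d (subst (d ≤_) (cong (t +_) (sym (+-identityʳ t)))
        (setDist≤within+within G dist a-near-u (knowers-near-Y a (all a))))
      where open Confined confined

    confined-delays : (connected : Connected (Adj G)) → ∀ {d s} → SetDist G u Y d →
      Confined Y u a 0 s → ∀ k → 2 * k < d → AdvDelays G (suc k) s
    confined-delays connected {d} dist confined₀ k 2k<d =
      delays-by-fixed-graph whole Budget ¬all preserved k (0 , 2k<d , confined₀)
      where
      whole : ConnSpanningSubgraph G
      whole = wholeGraph G connected

      Budget : ℕ → State n m → Set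
      Budget k s = ∃ λ t → 2 * (t + k) < d × Confined Y u a t s

      ¬all : ∀ {k s} → Budget k s → ¬ AllKnow s
      ¬all {k} (t , 2[t+k]<d , confined) =
        confined-¬AllKnow dist confined (≤-<-trans (*-monoʳ-≤ 2 (m≤m+n t k)) 2[t+k]<d)

      preserved : ∀ {k s p} → Budget (suc k) s → LegalMove whole s p → Budget k (next s p)
      preserved {k} (t , 2[t+1+k]<d , confined) move =
        suc t , subst (λ r → 2 * r < d) (+-suc t k) 2[t+1+k]<d , confined-next whole confined move

initially-confined : ∀ {n} (G : Graph n) {y x} {Y : Subset n} {u} (p : Fin (y + x) → Fin n) {a} →
  (∀ i → toℕ i < y → p i ∈ Y) → p a ≡ u → Confined G Y u a 0 (initial y x p)
initially-confined G p p-on-Y p-at-u = record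
  { knowers-near-Y = λ i i<y → within-of-∈ G (p-on-Y i i<y)
  ; a-near-u = within-of-∈ G p-at-u
  }

mainTheorem3 : ∀ {n} (G : Graph n) → Connected (Adj G) → (x y d : ℕ) →
    1 ≤ x → 1 ≤ y → x + y ≤ n → IsSetDiameter G y d →
    Σ (Fin (y + x) → Fin n) λ p → Injective _≡_ _≡_ p ×
      (∀ k → 2 * k < d → AdvDelays G (suc k) (initial y x p))
mainTheorem3 {n} G connected x y zero _ _ x+y≤n _ =
  (λ i → inject≤ i y+x≤n) , (λ {i} {j} → inject≤-injective _ _ i j) , λ _ ()
  where
  y+x≤n : y + x ≤ n
  y+x≤n = subst (_≤ n) (+-comm x y) x+y≤n
mainTheorem3 {n} G connected x y (suc d) 0<x _ x+y≤n ((u , Y , refl , dist) , _)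
  with p , p-injective , p-on-Y , a , p-at-u
         ← injective-placement Y u (setDist-suc⇒∉ G dist) x 0<x (subst (_≤ n) (+-comm x y) x+y≤n)
  = p , p-injective , confined-delays G connected dist (initially-confined G p p-on-Y p-at-u)
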